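{- Let $n\geq 2$, and let $G_1$ and $G_2$ be two distinct subgraphs of the augmented cube $AQ_n$, each isomorphic to the hypercube $Q_n$, chosen so that $|E(G_1)\cap E(G_2)|$ is minimum among all pairs of distinct $Q_n$-isomorphic subgraphs of $AQ_n$. Then $E(G_1)\cap E(G_2)$ is a perfect matching of $AQ_n$.
   Context: The hypercube $Q_n$ has vertex set $\{0,1\}^n$ (strings $x_n\cdots x_1$), two vertices adjacent iff they differ in exactly one bit. The augmented cube $AQ_n$ has vertex set $\{0,1\}^n$, and $u=u_n\cdots u_1$, $v=v_n\cdots v_1$ are adjacent iff either they differ in exactly one bit position (hypercube edge), or there is $j\in\{2,\dots,n\}$ such that $v_l\neq u_l$ for all $l\leq j$ and $v_l=u_l$ for all $l>j$ (augmented edge of dimension $j$). -}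

module Defs where

open import Data.Bool using (Bool; true; false; _∧_)
open import Data.Nat using (ℕ; zero; suc; _<_; _≤_)
open import Data.Fin using (Fin; toℕ)
open import Data.Vec using (Vec; []; _∷_; lookup)
open import Data.List using (List; []; _∷_; map; _++_; length; filter; concatMap)
open import Data.Product using (Σ; ∃; _×_; _,_)
open import Data.Sum using (_⊎_)
open import Data.Bool.Properties using (T?)
open import Function.Bundles using (_↔_; _⇔_; Inverse)
open import Relation.Binary.PropositionalEquality using (_≡_; _≢_)
open import Relation.Nullary using (¬_)

-- Vertices of Q_n and AQ_n: bit strings of length n.
-- Convention: for v : Vertex n and i : Fin n, `lookup v i` is the bit
-- x_{toℕ i + 1}; so index 0 is x_1 (the lowest bit), index n-1 is x_n.
Vertex : ℕ → Set
Vertex n = Vec Bool n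

QAdj : ∀ {n} → Vertex n → Vertex n → Set
QAdj {n} u v = Σ (Fin n) λ i →
  (lookup u i ≢ lookup v i) × (∀ (k : Fin n) → k ≢ i → lookup u k ≡ lookup v k)

-- Augmented edge of dimension j (2 ≤ j ≤ n): u and v differ in all
-- positions l ≤ j (i.e. indices with toℕ < j) and agree in all l > j.
AugAdj : ∀ {n} → Vertex n → Vertex n → Set
AugAdj {n} u v = Σ ℕ λ j → (2 ≤ j) × (j ≤ n) ×
  ((∀ (k : Fin n) → toℕ k < j → lookup u k ≢ lookup v k) ×
   (∀ (k : Fin n) → j ≤ toℕ k → lookup u k ≡ lookup v k))

AQAdj : ∀ {n} → Vertex n → Vertex n → Set
AQAdj u v = QAdj u v ⊎ AugAdj u v

record Subgraph (n : ℕ) : Set where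
  field
    E     : Vertex n → Vertex n → Bool
    sym   : ∀ u v → E u v ≡ E v u
    sub   : ∀ u v → E u v ≡ true → AQAdj u v
open Subgraph public

IsoQ : ∀ {n} → Subgraph n → Set
IsoQ {n} G = Σ (Vertex n ↔ Vertex n) λ f →
  ∀ x y → QAdj x y ⇔ (E G (Inverse.to f x) (Inverse.to f y) ≡ true)

Distinct : ∀ {n} → Subgraph n → Subgraph n → Set
Distinct G H = ¬ (∀ u v → E G u v ≡ E H u v)

allVertices : ∀ n → List (Vertex n)
allVertices zero = [] ∷ []
allVertices (suc n) = map (false ∷_) (allVertices n) ++ map (true ∷_) (allVertices n)

Common : ∀ {n} → Subgraph n → Subgraph n → Vertex n → Vertex n → Bool
Common G H u v = E G u v ∧ E H u v

-- Number of ORDERED pairs (u,v) with {u,v} ∈ E(G) ∩ E(H); this is exactly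
-- 2 · |E(G) ∩ E(H)| (edge relations are symmetric and irreflexive), so
-- comparisons of these counts are comparisons of |E(G) ∩ E(H)|.
commonCount : ∀ {n} → Subgraph n → Subgraph n → ℕ
commonCount {n} G H =
  length (filter (λ p → T? (Common G H (Data.Product.proj₁ p) (Data.Product.proj₂ p)))
                 (concatMap (λ u → map (λ v → (u , v)) (allVertices n)) (allVertices n)))

PerfectMatching : ∀ {n} → (Vertex n → Vertex n → Bool) → Set
PerfectMatching {n} M =
  (∀ u v → M u v ≡ true → AQAdj u v) ×
  (∀ (u : Vertex n) → Σ (Vertex n) λ v →
     (M u v ≡ true) × (∀ w → M u w ≡ true → w ≡ v))

-- Every vertex of AQ_n has 2n − 1 neighbours: one across each of the n hypercube
-- dimensions and one for each augmented dimension 2, …, n.  A copy of Q_n gives a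
-- vertex n distinct neighbours, so by pigeonhole two copies share an edge at every
-- vertex.  The bound is attained: relabelling Q_n by x_k ↦ x_k ⊕ x_{k+1} ⊕ ⋯ ⊕ x_n
-- turns its dimension-j edges into the augmented edges of dimension j (j ≥ 2), so this
-- copy meets the standard one exactly in the dimension-1 edges, a perfect matching.
-- For a minimising pair the common-edge degrees therefore sum to at most 2^n while
-- each is at least one, so each is exactly one.
{-# OPTIONS --safe #-}
module Submission where

open import Defs hiding (sym)
open import Data.Bool using (Bool; true; false; not; _∧_; _xor_)
open import Data.Bool.Properties as Bool
  using (T?; T-≡; not-¬; ¬-not; ∧-conicalˡ; ∧-conicalʳ;
         xor-assoc; xor-comm; xor-same; xor-identityʳ; not-distribˡ-xor; not-distribʳ-xor)
open import Data.Fin using (Fin; zero; suc; toℕ; fromℕ<; join; splitAt)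
open import Data.Fin.Properties using (toℕ<n; toℕ-fromℕ<; pigeonhole; <⇒≢; any?; all?; +↔⊎)
import Data.Fin.Properties as Fin
open import Data.List using (List; []; _∷_; map; _++_; length; filter; concat)
open import Data.List.Membership.Propositional using (_∈_)
open import Data.List.Membership.Propositional.Properties
  using (∈-map⁺; ∈-map⁻; ∈-++⁺ˡ; ∈-++⁺ʳ; ∈-filter⁺; ∈-filter⁻)
open import Data.List.Properties using (filter-++; length-++; map-∘; map-cong)
open import Data.List.Relation.Unary.Any using (here; there)
open import Data.List.Relation.Unary.All using ([]; _∷_)
open import Data.List.Relation.Unary.Unique.Propositional using (Unique; []; _∷_)
import Data.List.Relation.Unary.Unique.Propositional.Properties as Unique
open import Data.Nat using (ℕ; zero; suc; _+_; _≤_; _<_; z≤n; s≤s; s≤s⁻¹; _<?_)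
open import Data.Nat.ListAction using (sum)
open import Data.Nat.Properties
  using (≮⇒≥; ≤-trans; +-monoʳ-≤; +-monoˡ-≤; +-mono-≤; +-cancelʳ-≤; +-monoʳ-<; n<1+n; 1+n≢0)
open import Data.Product using (Σ; ∃; ∃₂; _×_; _,_; proj₁; proj₂)
open import Data.Sum using (_⊎_; inj₁; inj₂; [_,_])
open import Data.Sum.Properties using (inj₂-injective)
open import Data.Vec using ([]; _∷_; lookup; replicate; _[_]%=_)
open import Data.Vec.Properties using (lookup∘updateAt; lookup∘updateAt′; ∷-injectiveʳ)
open import Data.Vec.Relation.Binary.Pointwise.Extensional using (ext; Pointwise-≡⇒≡)
open import Function using (_∘_; _↔_; Inverse; Equivalence; Injection; mk⇔; mk↔ₛ′)
open import Function.Construct.Identity using (↔-id)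
open import Function.Construct.Symmetry using (↔-sym)
open import Function.Definitions using (Injective)
open import Function.Properties.Inverse using (↔⇒↣)
open import Relation.Binary.Definitions using (Decidable)
open import Relation.Binary.PropositionalEquality
  using (_≡_; _≢_; refl; sym; trans; cong; cong₂; subst; subst₂; module ≡-Reasoning)
open import Relation.Nullary using (¬_; Dec; yes; no; does; ¬?; _×-dec_; _→-dec_; contradiction)
open import Relation.Nullary.Decidable using (does-⇔; dec-true)

≢-unique : ∀ {a b c : Bool} → a ≢ b → a ≢ c → b ≡ c
≢-unique a≢b a≢c = trans (¬-not (a≢b ∘ sym)) (sym (¬-not (a≢c ∘ sym)))

xor-cancelʳ : ∀ a b → (a xor b) xor b ≡ a
xor-cancelʳ a b = trans (xor-assoc a b b) (trans (cong (a xor_) (xor-same b)) (xor-identityʳ a))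

xor-injectiveˡ : ∀ {a b} c → a xor c ≡ b xor c → a ≡ b
xor-injectiveˡ {a} {b} c e = trans (sym (xor-cancelʳ a c)) (trans (cong (_xor c) e) (xor-cancelʳ b c))

xor-injectiveʳ : ∀ a {c d} → a xor c ≡ a xor d → c ≡ d
xor-injectiveʳ a {c} {d} e = xor-injectiveˡ a (trans (xor-comm c a) (trans e (xor-comm a d)))

does⇒ : ∀ {A : Set} (a? : Dec A) → does a? ≡ true → A
does⇒ (yes a) _ = a
does⇒ (no _) ()

QAdj-sym : ∀ {n} (u v : Vertex n) → QAdj u v → QAdj v u
QAdj-sym u v (i , u≢v , rest) = i , u≢v ∘ sym , λ k k≢i → sym (rest k k≢i)

QAdj? : ∀ {n} → Decidable (QAdj {n})
QAdj? u v = any? λ i → ¬? (lookup u i Bool.≟ lookup v i)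
                ×-dec all? λ k → ¬? (k Fin.≟ i) →-dec (lookup u k Bool.≟ lookup v k)

QAdj-flip : ∀ {n} (x : Vertex n) i → QAdj x (x [ i ]%= not)
QAdj-flip x i = i , x≢flip , λ k k≢i → sym (lookup∘updateAt′ k i k≢i x)
  where
  x≢flip : lookup x i ≢ lookup (x [ i ]%= not) i
  x≢flip e = not-¬ refl (trans e (lookup∘updateAt i x))

flip-injective : ∀ {n} (x : Vertex n) → Injective _≡_ _≡_ (λ i → x [ i ]%= not)
flip-injective x {i} {j} e with i Fin.≟ j
... | yes i≡j = i≡j
... | no i≢j = contradiction (begin
  lookup x i                  ≡⟨ lookup∘updateAt′ i j i≢j x ⟨
  lookup (x [ j ]%= not) i    ≡⟨ cong (λ y → lookup y i) e ⟨
  lookup (x [ i ]%= not) i    ≡⟨ lookup∘updateAt i x ⟩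
  not (lookup x i)            ∎) (not-¬ refl)
  where open ≡-Reasoning

QAdj-unique : ∀ {n} {u w w′ : Vertex n} (p : QAdj u w) (q : QAdj u w′) → proj₁ p ≡ proj₁ q → w ≡ w′
QAdj-unique {w = w} {w′} (i , u≢w , rest) (_ , u≢w′ , rest′) refl = Pointwise-≡⇒≡ (ext pointwise)
  where
  pointwise : ∀ k → lookup w k ≡ lookup w′ k
  pointwise k with k Fin.≟ i
  ... | yes refl = ≢-unique u≢w u≢w′
  ... | no k≢i = trans (sym (rest k k≢i)) (rest′ k k≢i)

DiffersBelow : ∀ {n} → ℕ → Vertex n → Vertex n → Set
DiffersBelow {n} j u v =
  (∀ (k : Fin n) → toℕ k < j → lookup u k ≢ lookup v k) ×
  (∀ (k : Fin n) → j ≤ toℕ k → lookup u k ≡ lookup v k)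

DiffersBelow-unique : ∀ {n j} {u w w′ : Vertex n} → DiffersBelow j u w → DiffersBelow j u w′ → w ≡ w′
DiffersBelow-unique {j = j} {w = w} {w′} (differ , agree) (differ′ , agree′) = Pointwise-≡⇒≡ (ext pointwise)
  where
  pointwise : ∀ k → lookup w k ≡ lookup w′ k
  pointwise k with toℕ k <? j
  ... | yes k<j = ≢-unique (differ k k<j) (differ′ k k<j)
  ... | no k≮j = trans (sym (agree k (≮⇒≥ k≮j))) (agree′ k (≮⇒≥ k≮j))

DiffersBelow⇒AQAdj : ∀ {n} {u v : Vertex n} (i : Fin n) → DiffersBelow (suc (toℕ i)) u v → AQAdj u v
DiffersBelow⇒AQAdj zero (differ , agree) = inj₁ (zero , differ zero (s≤s z≤n) , λ
  { zero    k≢0 → contradiction refl k≢0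
  ; (suc k) _   → agree (suc k) (s≤s z≤n)
  })
DiffersBelow⇒AQAdj (suc i) D = inj₂ (suc (suc (toℕ i)) , s≤s (s≤s z≤n) , s≤s (toℕ<n i) , D)

QAdj-DiffersBelow⇒zero : ∀ {n} {u v : Vertex n} (i : Fin n) →
  QAdj u v → DiffersBelow (suc (toℕ i)) u v → toℕ i ≡ 0
QAdj-DiffersBelow⇒zero zero _ _ = refl
QAdj-DiffersBelow⇒zero (suc i) (zero , _ , rest) (differ , _) =
  contradiction (rest (suc i) (λ ())) (differ (suc i) (n<1+n _))
QAdj-DiffersBelow⇒zero (suc i) (suc l , _ , rest) (differ , _) =
  contradiction (rest zero (λ ())) (differ zero (s≤s z≤n))

augmentedDimension : ∀ {m} {u w : Vertex (suc m)} → AugAdj u w → Fin m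
augmentedDimension (zero , () , _)
augmentedDimension (suc zero , s≤s () , _)
augmentedDimension (suc (suc j) , _ , s≤s j<m , _) = fromℕ< j<m

augmentedDimension-DiffersBelow : ∀ {m} {u w : Vertex (suc m)} (a : AugAdj u w) →
  DiffersBelow (2 + toℕ (augmentedDimension {u = u} {w} a)) u w
augmentedDimension-DiffersBelow (zero , () , _)
augmentedDimension-DiffersBelow (suc zero , s≤s () , _)
augmentedDimension-DiffersBelow {u = u} {w} (suc (suc j) , _ , s≤s j<m , D) =
  subst (λ i → DiffersBelow (2 + i) u w) (sym (toℕ-fromℕ< j<m)) D

-- A record rather than a Σ-type, so that unification can recover u from the type.
record AQNeighbour {n} (u : Vertex n) : Set where
  constructor _,_
  field
    vertex   : Vertex n
    adjacent : AQAdj u vertex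
open AQNeighbour

-- The 2n − 1 edge directions at a vertex of AQ_n (n = suc m); augmented dimension j is stored as j − 2.
direction : ∀ {m} {u : Vertex (suc m)} → AQNeighbour u → Fin (suc m) ⊎ Fin m
direction (_ , inj₁ (i , _)) = inj₁ i
direction {u = u} (w , inj₂ a) = inj₂ (augmentedDimension {u = u} {w} a)

direction-injective : ∀ {m} {u : Vertex (suc m)} (p q : AQNeighbour u) →
  direction p ≡ direction q → vertex p ≡ vertex q
direction-injective {u = u} (w , inj₁ p) (w′ , inj₁ q) refl = QAdj-unique {u = u} {w} {w′} p q refl
direction-injective {u = u} (w , inj₂ a) (w′ , inj₂ b) e =
  DiffersBelow-unique {u = u} {w} {w′} (augmentedDimension-DiffersBelow {u = u} {w} a)
    (subst (λ j → DiffersBelow (2 + toℕ j) u w′) (sym (inj₂-injective e))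
      (augmentedDimension-DiffersBelow {u = u} {w′} b))

injective-images-intersect : ∀ {k l} → l < k + k → (f g : Fin k → Fin l) →
  Injective _≡_ _≡_ f → Injective _≡_ _≡_ g → ∃₂ λ i j → f i ≡ g j
injective-images-intersect {k} l<2k f g f-injective g-injective
  with a , b , a<b , same ← pigeonhole l<2k ([ f , g ] ∘ splitAt k)
  = meet (splitAt k a) (splitAt k b) (<⇒≢ a<b ∘ splitAt-injective) same
  where
  splitAt-injective : Injective _≡_ _≡_ (splitAt k {k})
  splitAt-injective = Injection.injective (↔⇒↣ +↔⊎)
  meet : (s t : Fin k ⊎ Fin k) → s ≢ t → [ f , g ] s ≡ [ f , g ] t → ∃₂ λ i j → f i ≡ g j
  meet (inj₁ i) (inj₁ j) s≢t e = contradiction (cong inj₁ (f-injective e)) s≢t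
  meet (inj₁ i) (inj₂ j) _   e = i , j , e
  meet (inj₂ i) (inj₁ j) _   e = j , i , sym e
  meet (inj₂ i) (inj₂ j) s≢t e = contradiction (cong inj₂ (g-injective e)) s≢t

module QCopy {n} (G : Subgraph n) (iso : IsoQ G) where
  open Inverse (proj₁ iso)

  neighbour : Vertex n → Fin n → Vertex n
  neighbour u i = to (from u [ i ]%= not)

  neighbour-edge : ∀ u i → E G u (neighbour u i) ≡ true
  neighbour-edge u i = subst (λ v → E G v (neighbour u i) ≡ true) (strictlyInverseˡ u)
    (Equivalence.to (proj₂ iso (from u) (from u [ i ]%= not)) (QAdj-flip (from u) i))

  aqNeighbour : ∀ u → Fin n → AQNeighbour u
  aqNeighbour u i = neighbour u i , sub G u (neighbour u i) (neighbour-edge u i)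

  neighbour-injective : ∀ u → Injective _≡_ _≡_ (neighbour u)
  neighbour-injective u = flip-injective (from u) ∘ Injection.injective (↔⇒↣ (proj₁ iso))

commonNeighbour : ∀ {m} (G₁ G₂ : Subgraph (suc m)) → IsoQ G₁ → IsoQ G₂ →
  ∀ u → ∃ λ v → Common G₁ G₂ u v ≡ true
commonNeighbour {m} G₁ G₂ iso₁ iso₂ u =
  sharedEdge (injective-images-intersect (+-monoʳ-< (suc m) (n<1+n m))
    code₁ code₂ code₁-injective code₂-injective)
  where
  module N₁ = QCopy G₁ iso₁
  module N₂ = QCopy G₂ iso₂
  code : AQNeighbour u → Fin (suc m + m)
  code = join (suc m) m ∘ direction
  code-injective : ∀ p q → code p ≡ code q → vertex p ≡ vertex q
  code-injective p q = direction-injective p q ∘ Injection.injective (↔⇒↣ (↔-sym (+↔⊎ {suc m} {m})))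
  code₁ code₂ : Fin (suc m) → Fin (suc m + m)
  code₁ = code ∘ N₁.aqNeighbour u
  code₂ = code ∘ N₂.aqNeighbour u
  code₁-injective : Injective _≡_ _≡_ code₁
  code₁-injective {i} {j} =
    N₁.neighbour-injective u ∘ code-injective (N₁.aqNeighbour u i) (N₁.aqNeighbour u j)
  code₂-injective : Injective _≡_ _≡_ code₂
  code₂-injective {i} {j} =
    N₂.neighbour-injective u ∘ code-injective (N₂.aqNeighbour u i) (N₂.aqNeighbour u j)
  sharedEdge : ∃₂ (λ i j → code₁ i ≡ code₂ j) → ∃ λ v → Common G₁ G₂ u v ≡ true
  sharedEdge (i , j , same) = N₁.neighbour u i , cong₂ _∧_ (N₁.neighbour-edge u i)
    (subst (λ v → E G₂ u v ≡ true) (sym (code-injective (N₁.aqNeighbour u i) (N₂.aqNeighbour u j) same))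
      (N₂.neighbour-edge u j))

Embeds : ∀ {n} → (Vertex n → Vertex n) → Set
Embeds σ = ∀ x y → QAdj x y → AQAdj (σ x) (σ y)

relabel : ∀ {n} (σ : Vertex n ↔ Vertex n) → Embeds (Inverse.to σ) → Subgraph n
relabel σ embeds = record
  { E   = λ u v → does (QAdj? (from u) (from v))
  ; sym = λ u v → does-⇔ (mk⇔ (QAdj-sym (from u) (from v)) (QAdj-sym (from v) (from u)))
                          (QAdj? (from u) (from v)) (QAdj? (from v) (from u))
  ; sub = λ u v e → subst₂ AQAdj (strictlyInverseˡ u) (strictlyInverseˡ v)
                      (embeds (from u) (from v) (does⇒ (QAdj? (from u) (from v)) e))
  }
  where open Inverse σ

relabel-IsoQ : ∀ {n} (σ : Vertex n ↔ Vertex n) (embeds : Embeds (Inverse.to σ)) → IsoQ (relabel σ embeds)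
relabel-IsoQ σ embeds = σ , λ x y → mk⇔
  (dec-true (QAdj? (from (to x)) (from (to y)))
     ∘ subst₂ QAdj (sym (strictlyInverseʳ x)) (sym (strictlyInverseʳ y)))
  (subst₂ QAdj (strictlyInverseʳ x) (strictlyInverseʳ y) ∘ does⇒ (QAdj? (from (to x)) (from (to y))))
  where open Inverse σ

parity : ∀ {n} → Vertex n → Bool
parity [] = false
parity (a ∷ x) = a xor parity x

suffixXor : ∀ {n} → Vertex n → Vertex n
suffixXor [] = []
suffixXor (a ∷ x) = (a xor parity x) ∷ suffixXor x

adjacentXor : ∀ {n} → Vertex n → Vertex n
adjacentXor [] = []
adjacentXor (a ∷ []) = a ∷ []
adjacentXor (a ∷ b ∷ y) = (a xor b) ∷ adjacentXor (b ∷ y)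

parity-adjacentXor : ∀ {n} a (y : Vertex n) → parity (adjacentXor (a ∷ y)) ≡ a
parity-adjacentXor a [] = xor-identityʳ a
parity-adjacentXor a (b ∷ y) = trans (cong ((a xor b) xor_) (parity-adjacentXor b y)) (xor-cancelʳ a b)

suffixXor-adjacentXor : ∀ {n} (y : Vertex n) → suffixXor (adjacentXor y) ≡ y
suffixXor-adjacentXor [] = refl
suffixXor-adjacentXor (a ∷ []) = cong (_∷ []) (xor-identityʳ a)
suffixXor-adjacentXor (a ∷ b ∷ y) =
  cong₂ _∷_ (trans (cong ((a xor b) xor_) (parity-adjacentXor b y)) (xor-cancelʳ a b))
            (suffixXor-adjacentXor (b ∷ y))

adjacentXor-suffixXor : ∀ {n} (x : Vertex n) → adjacentXor (suffixXor x) ≡ x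
adjacentXor-suffixXor [] = refl
adjacentXor-suffixXor (a ∷ []) = cong (_∷ []) (xor-identityʳ a)
adjacentXor-suffixXor (a ∷ b ∷ x) = cong₂ _∷_ (xor-cancelʳ a (parity (b ∷ x))) (adjacentXor-suffixXor (b ∷ x))

suffixXor-↔ : ∀ {n} → Vertex n ↔ Vertex n
suffixXor-↔ = mk↔ₛ′ suffixXor adjacentXor suffixXor-adjacentXor adjacentXor-suffixXor

parity-flip : ∀ {n} (x : Vertex n) i → parity (x [ i ]%= not) ≡ not (parity x)
parity-flip (a ∷ x) zero = sym (not-distribˡ-xor a (parity x))
parity-flip (a ∷ x) (suc i) = trans (cong (a xor_) (parity-flip x i)) (sym (not-distribʳ-xor a (parity x)))

suffixXor-flip : ∀ {n} (x : Vertex n) i → DiffersBelow (suc (toℕ i)) (suffixXor x) (suffixXor (x [ i ]%= not))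
suffixXor-flip (a ∷ x) zero =
    (λ { zero _ → not-¬ {a} refl ∘ xor-injectiveˡ (parity x) ; (suc k) (s≤s ()) })
  , (λ { zero () ; (suc k) _ → refl })
suffixXor-flip (a ∷ x) (suc i) with differ , agree ← suffixXor-flip x i =
    (λ { zero _ e → not-¬ refl (trans (xor-injectiveʳ a e) (parity-flip x i))
       ; (suc k) (s≤s k≤i) → differ k k≤i })
  , (λ { zero () ; (suc k) (s≤s i<k) → agree k i<k })

suffixXor-DiffersBelow : ∀ {n} {x y : Vertex n} (q : QAdj x y) →
  DiffersBelow (suc (toℕ (proj₁ q))) (suffixXor x) (suffixXor y)
suffixXor-DiffersBelow {x = x} {y} q@(i , _) =
  subst (DiffersBelow (suc (toℕ i)) (suffixXor x) ∘ suffixXor)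
    (QAdj-unique {u = x} {x [ i ]%= not} {y} (QAdj-flip x i) q refl) (suffixXor-flip x i)

suffixXor-embeds : ∀ {n} → Embeds (suffixXor {n})
suffixXor-embeds x y q =
  DiffersBelow⇒AQAdj {u = suffixXor x} {suffixXor y} (proj₁ q) (suffixXor-DiffersBelow {x = x} {y} q)

standardCopy : ∀ {n} → Subgraph n
standardCopy = relabel (↔-id (Vertex _)) λ _ _ → inj₁

twistedCopy : ∀ {n} → Subgraph n
twistedCopy = relabel suffixXor-↔ suffixXor-embeds

standardCopy-IsoQ : ∀ {n} → IsoQ (standardCopy {n})
standardCopy-IsoQ = relabel-IsoQ (↔-id (Vertex _)) λ _ _ → inj₁

twistedCopy-IsoQ : ∀ {n} → IsoQ (twistedCopy {n})
twistedCopy-IsoQ = relabel-IsoQ suffixXor-↔ suffixXor-embeds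

standard-twisted-common⇒DiffersBelow₁ : ∀ {n} (u v : Vertex n) →
  Common standardCopy twistedCopy u v ≡ true → DiffersBelow 1 u v
standard-twisted-common⇒DiffersBelow₁ u v e =
  subst (λ j → DiffersBelow (suc j) u v) (QAdj-DiffersBelow⇒zero {u = u} {v} (proj₁ q₂) q₁ d) d
  where
  q₁ : QAdj u v
  q₁ = does⇒ (QAdj? u v) (∧-conicalˡ _ _ e)
  q₂ : QAdj (adjacentXor u) (adjacentXor v)
  q₂ = does⇒ (QAdj? (adjacentXor u) (adjacentXor v)) (∧-conicalʳ _ _ e)
  d : DiffersBelow (suc (toℕ (proj₁ q₂))) u v
  d = subst₂ (DiffersBelow _) (suffixXor-adjacentXor u) (suffixXor-adjacentXor v)
        (suffixXor-DiffersBelow {x = adjacentXor u} {adjacentXor v} q₂)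

standardCopy≢twistedCopy : ∀ {m} → Distinct (standardCopy {suc (suc m)}) twistedCopy
standardCopy≢twistedCopy {m} same =
  1+n≢0 (QAdj-DiffersBelow⇒zero {u = suffixXor x} {suffixXor y} (suc zero) q (suffixXor-flip x (suc zero)))
  where
  x y : Vertex (suc (suc m))
  x = replicate _ false
  y = x [ suc zero ]%= not
  q : QAdj (suffixXor x) (suffixXor y)
  q = does⇒ (QAdj? (suffixXor x) (suffixXor y))
        (trans (same (suffixXor x) (suffixXor y))
               (Equivalence.to (proj₂ twistedCopy-IsoQ x y) (QAdj-flip x (suc zero))))

count : ∀ {A : Set} → (A → Bool) → List A → ℕ
count p = length ∘ filter (T? ∘ p)

count-++ : ∀ {A : Set} (p : A → Bool) xs ys → count p (xs ++ ys) ≡ count p xs + count p ys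
count-++ p xs ys = trans (cong length (filter-++ (T? ∘ p) xs ys)) (length-++ (filter (T? ∘ p) xs))

count-concat : ∀ {A : Set} (p : A → Bool) xss → count p (concat xss) ≡ sum (map (count p) xss)
count-concat p [] = refl
count-concat p (xs ∷ xss) = trans (count-++ p xs (concat xss)) (cong (count p xs +_) (count-concat p xss))

count-map : ∀ {A B : Set} (p : B → Bool) (f : A → B) xs → count p (map f xs) ≡ count (p ∘ f) xs
count-map p f [] = refl
count-map p f (x ∷ xs) with p (f x)
... | true  = cong suc (count-map p f xs)
... | false = count-map p f xs

count-≥1 : ∀ {A : Set} {p : A → Bool} {x xs} → x ∈ xs → p x ≡ true → 1 ≤ count p xs
count-≥1 {p = p} x∈xs px = nonEmpty (∈-filter⁺ (T? ∘ p) x∈xs (Equivalence.from T-≡ px))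
  where
  nonEmpty : ∀ {x ys} → x ∈ ys → 1 ≤ length ys
  nonEmpty (here _)  = s≤s z≤n
  nonEmpty (there _) = s≤s z≤n

count≤1⇒≡ : ∀ {A : Set} {p : A → Bool} {x y xs} → count p xs ≤ 1 →
  x ∈ xs → y ∈ xs → p x ≡ true → p y ≡ true → x ≡ y
count≤1⇒≡ {p = p} {xs = xs} c≤1 x∈xs y∈xs px py =
  singleton (filter (T? ∘ p) xs) c≤1 (∈-filter⁺ (T? ∘ p) x∈xs (Equivalence.from T-≡ px))
    (∈-filter⁺ (T? ∘ p) y∈xs (Equivalence.from T-≡ py))
  where
  singleton : ∀ {x y} ys → length ys ≤ 1 → x ∈ ys → y ∈ ys → x ≡ y
  singleton (_ ∷ []) _ (here refl) (here refl) = refl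
  singleton (_ ∷ _ ∷ _) (s≤s ())

count≤1 : ∀ {A : Set} {p : A → Bool} {xs} → Unique xs →
  (∀ {x y} → p x ≡ true → p y ≡ true → x ≡ y) → count p xs ≤ 1
count≤1 {p = p} {xs} unique same = singleton (Unique.filter⁺ (T? ∘ p) unique) λ x∈ y∈ →
  same (satisfies x∈) (satisfies y∈)
  where
  satisfies : ∀ {x} → x ∈ filter (T? ∘ p) xs → p x ≡ true
  satisfies = Equivalence.to T-≡ ∘ proj₂ ∘ ∈-filter⁻ (T? ∘ p) {xs = xs}
  singleton : ∀ {ys} → Unique ys → (∀ {x y} → x ∈ ys → y ∈ ys → x ≡ y) → length ys ≤ 1
  singleton [] _ = z≤n
  singleton (_ ∷ []) _ = s≤s z≤n
  singleton ((x≢y ∷ _) ∷ _) same = contradiction (same (here refl) (there (here refl))) x≢y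

allVertices-complete : ∀ {n} (v : Vertex n) → v ∈ allVertices n
allVertices-complete [] = here refl
allVertices-complete {suc n} (false ∷ v) = ∈-++⁺ˡ (∈-map⁺ (false ∷_) (allVertices-complete v))
allVertices-complete {suc n} (true ∷ v) =
  ∈-++⁺ʳ (map (false ∷_) (allVertices n)) (∈-map⁺ (true ∷_) (allVertices-complete v))

allVertices-unique : ∀ n → Unique (allVertices n)
allVertices-unique zero = [] ∷ []
allVertices-unique (suc n) =
  Unique.++⁺ (Unique.map⁺ ∷-injectiveʳ (allVertices-unique n)) (Unique.map⁺ ∷-injectiveʳ (allVertices-unique n))
             disjoint
  where
  disjoint : ∀ {v} → ¬ (v ∈ map (false ∷_) (allVertices n) × v ∈ map (true ∷_) (allVertices n))
  disjoint (v∈₀ , v∈₁) with ∈-map⁻ (false ∷_) v∈₀ | ∈-map⁻ (true ∷_) v∈₁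
  ... | _ , _ , refl | _ , _ , ()

degree : ∀ {n} → (Vertex n → Vertex n → Bool) → Vertex n → ℕ
degree {n} M u = count (M u) (allVertices n)

degree-≥1 : ∀ {n} (M : Vertex n → Vertex n → Bool) {u v} → M u v ≡ true → 1 ≤ degree M u
degree-≥1 M {v = v} = count-≥1 {p = M _} (allVertices-complete v)

degree≤1⇒≡ : ∀ {n} (M : Vertex n → Vertex n → Bool) {u v w} → degree M u ≤ 1 →
  M u v ≡ true → M u w ≡ true → v ≡ w
degree≤1⇒≡ M {v = v} {w} d≤1 = count≤1⇒≡ {p = M _} d≤1 (allVertices-complete v) (allVertices-complete w)

degree≤1 : ∀ {n} (M : Vertex n → Vertex n → Bool) {u} →
  (∀ {v w} → M u v ≡ true → M u w ≡ true → v ≡ w) → degree M u ≤ 1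
degree≤1 {n} M = count≤1 {p = M _} (allVertices-unique n)

commonCount≡sum-degree : ∀ {n} (G H : Subgraph n) →
  commonCount G H ≡ sum (map (degree (Common G H)) (allVertices n))
commonCount≡sum-degree {n} G H = begin
  count P (concat (map incident A))     ≡⟨ count-concat P (map incident A) ⟩
  sum (map (count P) (map incident A))  ≡⟨ cong sum (map-∘ A) ⟨
  sum (map (count P ∘ incident) A)      ≡⟨ cong sum (map-cong (λ u → count-map P (u ,_) A) A) ⟩
  sum (map (degree (Common G H)) A)     ∎
  where
  open ≡-Reasoning
  A = allVertices n
  P : Vertex n × Vertex n → Bool
  P (u , v) = Common G H u v
  incident : Vertex n → List (Vertex n × Vertex n)
  incident u = map (u ,_) A

sum-map-≤-length : ∀ {A : Set} {f : A → ℕ} → (∀ x → f x ≤ 1) → ∀ xs → sum (map f xs) ≤ length xs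
sum-map-≤-length f≤1 [] = z≤n
sum-map-≤-length f≤1 (x ∷ xs) = +-mono-≤ (f≤1 x) (sum-map-≤-length f≤1 xs)

length≤sum-map : ∀ {A : Set} {f : A → ℕ} → (∀ x → 1 ≤ f x) → ∀ xs → length xs ≤ sum (map f xs)
length≤sum-map 1≤f [] = z≤n
length≤sum-map 1≤f (x ∷ xs) = +-mono-≤ (1≤f x) (length≤sum-map 1≤f xs)

sum-map-≤-length⇒≤1 : ∀ {A : Set} {f : A → ℕ} → (∀ x → 1 ≤ f x) →
  ∀ {x xs} → sum (map f xs) ≤ length xs → x ∈ xs → f x ≤ 1
sum-map-≤-length⇒≤1 {f = f} 1≤f {xs = y ∷ ys} bound (here refl) =
  +-cancelʳ-≤ (length ys) (f y) 1 (≤-trans (+-monoʳ-≤ (f y) (length≤sum-map 1≤f ys)) bound)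
sum-map-≤-length⇒≤1 {f = f} 1≤f {xs = y ∷ ys} bound (there x∈ys) =
  sum-map-≤-length⇒≤1 1≤f (s≤s⁻¹ (≤-trans (+-monoˡ-≤ (sum (map f ys)) (1≤f y)) bound)) x∈ys

standard-twisted-commonCount : ∀ {n} → commonCount (standardCopy {n}) twistedCopy ≤ length (allVertices n)
standard-twisted-commonCount {n} =
  subst (_≤ length (allVertices n)) (sym (commonCount≡sum-degree {n} standardCopy twistedCopy))
    (sum-map-≤-length {f = degree C} (λ u → degree≤1 C {u} λ {v} {w} e e′ →
      DiffersBelow-unique {u = u} (standard-twisted-common⇒DiffersBelow₁ u v e)
                                  (standard-twisted-common⇒DiffersBelow₁ u w e′))
      (allVertices n))
  where
  C = Common (standardCopy {n}) twistedCopy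

theorem3p2 : (n : ℕ) → 2 ≤ n → (G₁ G₂ : Subgraph n) →
    IsoQ G₁ → IsoQ G₂ → Distinct G₁ G₂ →
    (∀ (H₁ H₂ : Subgraph n) → IsoQ H₁ → IsoQ H₂ → Distinct H₁ H₂ →
       commonCount G₁ G₂ ≤ commonCount H₁ H₂) →
    PerfectMatching (Common G₁ G₂)
theorem3p2 (suc zero) (s≤s ())
theorem3p2 n@(suc (suc m)) _ G₁ G₂ iso₁ iso₂ _ minimal = (λ u v → sub G₁ u v ∘ ∧-conicalˡ _ _) , matched
  where
  A = allVertices n
  C = Common G₁ G₂
  partner : ∀ u → ∃ λ v → C u v ≡ true
  partner = commonNeighbour G₁ G₂ iso₁ iso₂
  commonCount≤2ⁿ : commonCount G₁ G₂ ≤ length A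
  commonCount≤2ⁿ =
    ≤-trans (minimal standardCopy twistedCopy standardCopy-IsoQ twistedCopy-IsoQ standardCopy≢twistedCopy)
            (standard-twisted-commonCount {n})
  degree-C≤1 : ∀ u → degree C u ≤ 1
  degree-C≤1 u = sum-map-≤-length⇒≤1 {f = degree C} (λ u → degree-≥1 C (proj₂ (partner u)))
    (subst (_≤ length A) (commonCount≡sum-degree G₁ G₂) commonCount≤2ⁿ) (allVertices-complete u)
  matched : ∀ u → Σ (Vertex n) λ v → (C u v ≡ true) × (∀ w → C u w ≡ true → w ≡ v)
  matched u = proj₁ (partner u) , proj₂ (partner u) , λ w e →
    degree≤1⇒≡ C (degree-C≤1 u) e (proj₂ (partner u))
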